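{- Let $d\ge 2$ and fix $i$ with $0\le i\le d$. Let $a_j\in\mathbb Q$ be given for all $j\in\{0,\dots,d\}\setminus\{i\}$, such that $a_0\neq 0$ if $i\neq 0$ and $a_d\neq 0$ if $i\neq d$. Then there exists a nonzero integer $a_i\in\mathbb Z$ such that the polynomial $f(x)=a_dx^d+a_{d-1}x^{d-1}+\cdots+a_1x+a_0$ has no roots in $\mathbb Q$. -}

module Defs where

open import Data.Nat using (ℕ; zero; suc)
open import Data.Fin using (Fin; zero; suc; toℕ; _≟_)
open import Data.Rational using (ℚ; 0ℚ; _+_; _*_; 1ℚ)
open import Relation.Nullary using (yes; no)

_^_ : ℚ → ℕ → ℚ
x ^ zero  = 1ℚ
x ^ suc n = x * (x ^ n)

finSum : (n : ℕ) → (Fin n → ℚ) → ℚ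
finSum zero    f = 0ℚ
finSum (suc n) f = f zero + finSum n (λ j → f (suc j))

evalPoly : (d : ℕ) → (Fin (suc d) → ℚ) → ℚ → ℚ
evalPoly d c x = finSum (suc d) (λ j → c j * (x ^ toℕ j))

-- Coefficient vector obtained from a by setting the i-th coefficient to b
-- (the given value a i is ignored).
setCoeff : {n : ℕ} → (Fin n → ℚ) → Fin n → ℚ → (Fin n → ℚ)
setCoeff a i b j with j ≟ i
... | yes _ = b
... | no  _ = a j

module Submission where

-- Write V·a_j = e_j ∈ ℤ with V ≥ 1 and |e_j| ≤ M, put R = V + M, and take
-- a_i = P a prime above d·R·R^d·R^d; the integer coefficients are c_j = e_j
-- (j ≠ i) and c_i = V·P.  A root N/q in lowest terms makes Σ_j c_j N^j q^(d-j)
-- vanish, so each term is at most d times the largest other one, and (rational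
-- root theorem) N ∣ c_0, q ∣ c_d.  A divisor of V·P is ≤ V or ≥ P, so |N| and q
-- are ≤ R except that |N| ≥ P is possible when i = 0 (q ≥ P when i = d).  So one
-- term is too big: c_i N^i q^(d-i) ≥ P when |N|, q ≤ R (others ≤ R·R^d·R^d), or
-- c_d N^d if u = |N| ≥ P, c_0 q^d if u = q ≥ P (others ≤ R·R^d·u^(d-1), d ≥ 2).

open import Defs using (finSum; evalPoly; setCoeff) renaming (_^_ to _^ℚ_)
open import Data.Nat as ℕ using (ℕ; zero; suc; _+_; _*_; _^_; _∸_; _≤_; _<_; _≥_; z≤n; s≤s; NonZero)
import Data.Nat.Properties as ℕP
open import Data.Nat.Divisibility using (_∣_; ∣-trans; ∣⇒≤; 0∣⇒≡0; ∣1⇒≡1; ∣m+n∣m⇒∣n; m∣m*n; m≤n⇒m!∣n!)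
open import Data.Nat.Coprimality as Coprimality using (Coprime; coprime-divisor; prime⇒coprime)
open import Data.Nat.Primality using (Prime; prime⇒nonZero; prime⇒nonTrivial)
open import Data.Nat.Primality.Factorisation using (PrimeFactorisation; factorise)
open import Data.Nat.ListAction using (product)
import Data.Nat.Tactic.RingSolver as ℕ-Solver
open import Data.Integer as ℤ using (ℤ; +_; 0ℤ; ∣_∣)
import Data.Integer.Properties as ℤP
open import Data.Integer.Divisibility.Signed using (∣-refl; ∣m+n∣n⇒∣m; ∣m∣n⇒∣m+n; ∣m⇒∣m*n; ∣n⇒∣m*n; ∣⇒∣ᵤ) renaming (_∣_ to _∣ℤ_)
open import Data.Integer.Tactic.RingSolver using (solve-∀)
open import Algebra.Properties.Semiring.Sum ℤP.+-*-semiring using (sum; sum-remove)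
open import Algebra.Properties.AbelianGroup ℤP.+-0-abelianGroup using (inverseˡ-unique)
open import Data.Rational as ℚ using (ℚ; 0ℚ; _/_; mkℚ; toℚᵘ)
import Data.Rational.Properties as ℚP
open import Data.Rational.Unnormalised as ℚᵘ using (mkℚᵘ; *≡*; _≃_)
import Data.Rational.Unnormalised.Properties as ℚᵘP
open import Data.Rational.Solver using (module +-*-Solver)
open +-*-Solver using (solve; _:*_; _:=_)
open import Data.Fin using (Fin; zero; suc; toℕ; fromℕ; punchIn; _≟_)
import Data.Fin.Properties as FinP
open import Data.Vec.Functional using (removeAt; updateAt)
open import Data.Vec.Functional.Properties using (updateAt-updates; updateAt-minimal)
open import Data.List using ([]; _∷_)
open import Data.List.Relation.Unary.All using (All; _∷_)
open import Data.Product using (∃; _×_; _,_)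
open import Data.Sum using (_⊎_; inj₁; inj₂; [_,_]′) renaming (map to ⊎-map)
open import Data.Empty using (⊥; ⊥-elim)
open import Relation.Nullary using (Dec; yes; no)
open import Relation.Binary.PropositionalEquality
open import Function using (_∘_)

ι : ℤ → ℚ
ι m = m / 1

ι-unnormalised : ∀ m → toℚᵘ (ι m) ≃ mkℚᵘ m 0
ι-unnormalised m = ℚP.toℚᵘ-fromℚᵘ (mkℚᵘ m 0)

ι-+ : ∀ a b → ι (a ℤ.+ b) ≡ ι a ℚ.+ ι b
ι-+ a b = ℚP.toℚᵘ-injective (begin
  toℚᵘ (ι (a ℤ.+ b))              ≈⟨ ι-unnormalised (a ℤ.+ b) ⟩
  mkℚᵘ (a ℤ.+ b) 0                ≈⟨ *≡* (fraction-+ a b) ⟩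
  mkℚᵘ a 0 ℚᵘ.+ mkℚᵘ b 0          ≈⟨ ℚᵘP.+-cong (ι-unnormalised a) (ι-unnormalised b) ⟨
  toℚᵘ (ι a) ℚᵘ.+ toℚᵘ (ι b)      ≈⟨ ℚP.toℚᵘ-homo-+ (ι a) (ι b) ⟨
  toℚᵘ (ι a ℚ.+ ι b)              ∎)
  where
  open ℚᵘP.≃-Reasoning
  fraction-+ : ∀ a b → (a ℤ.+ b) ℤ.* (+ 1 ℤ.* + 1) ≡ (a ℤ.* + 1 ℤ.+ b ℤ.* + 1) ℤ.* + 1
  fraction-+ = solve-∀

ι-* : ∀ a b → ι (a ℤ.* b) ≡ ι a ℚ.* ι b
ι-* a b = ℚP.toℚᵘ-injective (begin
  toℚᵘ (ι (a ℤ.* b))              ≈⟨ ι-unnormalised (a ℤ.* b) ⟩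
  mkℚᵘ (a ℤ.* b) 0                ≈⟨ *≡* (fraction-* a b) ⟩
  mkℚᵘ a 0 ℚᵘ.* mkℚᵘ b 0          ≈⟨ ℚᵘP.*-cong (ι-unnormalised a) (ι-unnormalised b) ⟨
  toℚᵘ (ι a) ℚᵘ.* toℚᵘ (ι b)      ≈⟨ ℚP.toℚᵘ-homo-* (ι a) (ι b) ⟨
  toℚᵘ (ι a ℚ.* ι b)              ∎)
  where
  open ℚᵘP.≃-Reasoning
  fraction-* : ∀ a b → (a ℤ.* b) ℤ.* (+ 1 ℤ.* + 1) ≡ (a ℤ.* b) ℤ.* + 1
  fraction-* = solve-∀

ι-^ : ∀ a k → ι (a ℤ.^ k) ≡ ι a ^ℚ k
ι-^ a zero    = refl
ι-^ a (suc k) = trans (ι-* a (a ℤ.^ k)) (cong (ι a ℚ.*_) (ι-^ a k))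

ι-injective : ∀ {a b} → ι a ≡ ι b → a ≡ b
ι-injective {a} {b} eq with ℚᵘP.≃-trans (ℚᵘP.≃-sym (ι-unnormalised a)) (ℚᵘP.≃-trans (ℚP.toℚᵘ-cong eq) (ι-unnormalised b))
... | *≡* a*1≡b*1 = trans (sym (ℤP.*-identityʳ a)) (trans a*1≡b*1 (ℤP.*-identityʳ b))

ι-pos-* : ∀ x y → ι (+ (x * y)) ≡ ι (+ x) ℚ.* ι (+ y)
ι-pos-* x y = trans (cong ι (ℤP.pos-* x y)) (ι-* (+ x) (+ y))

↧-clears : ∀ p → p ℚ.* ι (ℚ.↧ p) ≡ ι (ℚ.↥ p)
↧-clears p@(mkℚ n d _) = ℚP.toℚᵘ-injective (begin
  toℚᵘ (p ℚ.* ι (ℚ.↧ p))                 ≈⟨ ℚP.toℚᵘ-homo-* p (ι (ℚ.↧ p)) ⟩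
  mkℚᵘ n d ℚᵘ.* toℚᵘ (ι (ℚ.↧ p))          ≈⟨ ℚᵘP.*-congˡ {mkℚᵘ n d} (ι-unnormalised (ℚ.↧ p)) ⟩
  mkℚᵘ n d ℚᵘ.* mkℚᵘ (ℚ.↧ p) 0           ≈⟨ *≡* (cancel n (ℚ.↧ p)) ⟩
  mkℚᵘ n 0                              ≈⟨ ι-unnormalised n ⟨
  toℚᵘ (ι n)                            ∎)
  where
  open ℚᵘP.≃-Reasoning
  cancel : ∀ n D → (n ℤ.* D) ℤ.* + 1 ≡ n ℤ.* (D ℤ.* + 1)
  cancel = solve-∀

^ℚ-distrib-* : ∀ x y k → (x ℚ.* y) ^ℚ k ≡ x ^ℚ k ℚ.* y ^ℚ k
^ℚ-distrib-* x y zero    = refl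
^ℚ-distrib-* x y (suc k) = begin
  (x ℚ.* y) ℚ.* (x ℚ.* y) ^ℚ k           ≡⟨ cong ((x ℚ.* y) ℚ.*_) (^ℚ-distrib-* x y k) ⟩
  (x ℚ.* y) ℚ.* (x ^ℚ k ℚ.* y ^ℚ k)     ≡⟨ interchange x y (x ^ℚ k) (y ^ℚ k) ⟩
  (x ℚ.* x ^ℚ k) ℚ.* (y ℚ.* y ^ℚ k)     ∎
  where
  open ≡-Reasoning
  interchange : ∀ a b c e → (a ℚ.* b) ℚ.* (c ℚ.* e) ≡ (a ℚ.* c) ℚ.* (b ℚ.* e)
  interchange = solve 4 (λ a b c e → (a :* b) :* (c :* e) := (a :* c) :* (b :* e)) refl

^ℚ-+ : ∀ x k l → x ^ℚ k ℚ.* x ^ℚ l ≡ x ^ℚ (k + l)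
^ℚ-+ x zero    l = ℚP.*-identityˡ (x ^ℚ l)
^ℚ-+ x (suc k) l = trans (ℚP.*-assoc x (x ^ℚ k) (x ^ℚ l)) (cong (x ℚ.*_) (^ℚ-+ x k l))

-- ℚ has no zero divisors: the numerator of a product is, up to a gcd factor,
-- the product of the numerators.
ℚ-zero-product : ∀ p r → p ℚ.* r ≡ 0ℚ → p ≡ 0ℚ ⊎ r ≡ 0ℚ
ℚ-zero-product p r pr≡0 = ⊎-map (ℚP.↥p≡0⇒p≡0 p) (ℚP.↥p≡0⇒p≡0 r)
  (ℤP.i*j≡0⇒i≡0∨j≡0 (ℚ.↥ p) (product-zero (ℚP.↥-* p r) (cong ℚ.↥_ pr≡0)))
  where
  product-zero : ∀ {x y z} → x ℤ.* y ≡ z → x ≡ 0ℤ → z ≡ 0ℤ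
  product-zero {y = y} refl refl = ℤP.*-zeroˡ y

ι-sum : ∀ n (f : Fin n → ℤ) → ι (sum f) ≡ finSum n (ι ∘ f)
ι-sum zero    f = refl
ι-sum (suc n) f = trans (ι-+ (f zero) (sum (f ∘ suc))) (cong (ι (f zero) ℚ.+_) (ι-sum n (f ∘ suc)))

finSum-cong : ∀ n {f g : Fin n → ℚ} → (∀ j → f j ≡ g j) → finSum n f ≡ finSum n g
finSum-cong zero    f≗g = refl
finSum-cong (suc n) f≗g = cong₂ ℚ._+_ (f≗g zero) (finSum-cong n (f≗g ∘ suc))

finSum-scale : ∀ n K (f : Fin n → ℚ) → finSum n (λ j → K ℚ.* f j) ≡ K ℚ.* finSum n f
finSum-scale zero    K f = sym (ℚP.*-zeroʳ K)
finSum-scale (suc n) K f = trans (cong (K ℚ.* f zero ℚ.+_) (finSum-scale n K (f ∘ suc)))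
                                 (sym (ℚP.*-distribˡ-+ K (f zero) (finSum n (f ∘ suc))))

∣sum∣≤ : ∀ {n} (f : Fin n → ℤ) B → (∀ j → ∣ f j ∣ ≤ B) → ∣ sum f ∣ ≤ n * B
∣sum∣≤ {zero}  f B bounded = z≤n
∣sum∣≤ {suc n} f B bounded = ℕP.≤-trans (ℤP.∣i+j∣≤∣i∣+∣j∣ (f zero) (sum (f ∘ suc)))
                                        (ℕP.+-mono-≤ (bounded zero) (∣sum∣≤ (f ∘ suc) B (bounded ∘ suc)))

∣0 : ∀ m → m ∣ℤ 0ℤ
∣0 m = ∣n⇒∣m*n 0ℤ ∣-refl   -- 0ℤ * m computes to 0ℤ

∣-sum : ∀ {n} m (f : Fin n → ℤ) → (∀ j → m ∣ℤ f j) → m ∣ℤ sum f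
∣-sum {zero}  m f divides = ∣0 m
∣-sum {suc n} m f divides = ∣m∣n⇒∣m+n (divides zero) (∣-sum m (f ∘ suc) (divides ∘ suc))

vanishing-isolate : ∀ {n} (t : Fin (suc n) → ℤ) k → sum t ≡ 0ℤ → t k ≡ ℤ.- sum (removeAt t k)
vanishing-isolate t k sum≡0 = inverseˡ-unique (t k) (sum (removeAt t k)) (trans (sym (sum-remove {i = k} t)) sum≡0)

vanishing-dominated : ∀ {n} (t : Fin (suc n) → ℤ) k B → sum t ≡ 0ℤ →
                      (∀ j → j ≢ k → ∣ t j ∣ ≤ B) → ∣ t k ∣ ≤ n * B
vanishing-dominated {n} t k B sum≡0 others≤B = begin
  ∣ t k ∣                        ≡⟨ cong ∣_∣ (vanishing-isolate t k sum≡0) ⟩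
  ∣ ℤ.- sum (removeAt t k) ∣     ≡⟨ ℤP.∣-i∣≡∣i∣ (sum (removeAt t k)) ⟩
  ∣ sum (removeAt t k) ∣         ≤⟨ ∣sum∣≤ (removeAt t k) B (λ j → others≤B (punchIn k j) (FinP.punchInᵢ≢i k j)) ⟩
  n * B                          ∎
  where open ℕP.≤-Reasoning

vanishing-divides : ∀ {n} (t : Fin (suc n) → ℤ) k m → sum t ≡ 0ℤ →
                    (∀ j → j ≢ k → m ∣ℤ t j) → m ∣ℤ t k
vanishing-divides t k m sum≡0 m∣others = ∣m+n∣n⇒∣m m∣tk+rest m∣rest
  where
  m∣rest : m ∣ℤ sum (removeAt t k)
  m∣rest = ∣-sum m (removeAt t k) (λ j → m∣others (punchIn k j) (FinP.punchInᵢ≢i k j))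
  m∣tk+rest : m ∣ℤ t k ℤ.+ sum (removeAt t k)
  m∣tk+rest = subst (m ∣ℤ_) (trans (sym sum≡0) (sum-remove {i = k} t)) (∣0 m)

homTerm : (d : ℕ) → (Fin (suc d) → ℤ) → ℤ → ℤ → Fin (suc d) → ℤ
homTerm d c N Q j = c j ℤ.* N ℤ.^ toℕ j ℤ.* Q ℤ.^ (d ∸ toℕ j)

homogenise : ∀ d (c : Fin (suc d) → ℤ) (b : Fin (suc d) → ℚ) V N Q x →
             (∀ j → ι (c j) ≡ ι V ℚ.* b j) → x ℚ.* ι Q ≡ ι N →
             ι (sum (homTerm d c N Q)) ≡ (ι V ℚ.* ι Q ^ℚ d) ℚ.* evalPoly d b x
homogenise d c b V N Q x c≡Vb x≡N/Q = begin
  ι (sum (homTerm d c N Q))                                  ≡⟨ ι-sum (suc d) (homTerm d c N Q) ⟩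
  finSum (suc d) (ι ∘ homTerm d c N Q)                       ≡⟨ finSum-cong (suc d) term ⟩
  finSum (suc d) (λ j → (ι V ℚ.* ι Q ^ℚ d) ℚ.* (b j ℚ.* x ^ℚ toℕ j))
                                                             ≡⟨ finSum-scale (suc d) (ι V ℚ.* ι Q ^ℚ d) (λ j → b j ℚ.* x ^ℚ toℕ j) ⟩
  (ι V ℚ.* ι Q ^ℚ d) ℚ.* evalPoly d b x                      ∎
  where
  open ≡-Reasoning
  rearrange : ∀ v b xk qk ql → v ℚ.* b ℚ.* (xk ℚ.* qk) ℚ.* ql ≡ (v ℚ.* (qk ℚ.* ql)) ℚ.* (b ℚ.* xk)
  rearrange = solve 5 (λ v b xk qk ql → v :* b :* (xk :* qk) :* ql := (v :* (qk :* ql)) :* (b :* xk)) refl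
  term : ∀ j → ι (homTerm d c N Q j) ≡ (ι V ℚ.* ι Q ^ℚ d) ℚ.* (b j ℚ.* x ^ℚ toℕ j)
  term j = begin
    ι (c j ℤ.* N ℤ.^ k ℤ.* Q ℤ.^ (d ∸ k))                       ≡⟨ trans (ι-* (c j ℤ.* N ℤ.^ k) _) (cong₂ ℚ._*_ (ι-* (c j) (N ℤ.^ k)) (ι-^ Q (d ∸ k))) ⟩
    ι (c j) ℚ.* ι (N ℤ.^ k) ℚ.* ι Q ^ℚ (d ∸ k)                  ≡⟨ cong (λ z → ι (c j) ℚ.* z ℚ.* ι Q ^ℚ (d ∸ k)) (ι-^ N k) ⟩
    ι (c j) ℚ.* ι N ^ℚ k ℚ.* ι Q ^ℚ (d ∸ k)                     ≡⟨ cong₂ (λ u w → u ℚ.* w ℚ.* ι Q ^ℚ (d ∸ k)) (c≡Vb j) N^k ⟩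
    ι V ℚ.* b j ℚ.* (x ^ℚ k ℚ.* ι Q ^ℚ k) ℚ.* ι Q ^ℚ (d ∸ k)     ≡⟨ rearrange (ι V) (b j) (x ^ℚ k) (ι Q ^ℚ k) (ι Q ^ℚ (d ∸ k)) ⟩
    (ι V ℚ.* (ι Q ^ℚ k ℚ.* ι Q ^ℚ (d ∸ k))) ℚ.* (b j ℚ.* x ^ℚ k) ≡⟨ cong (λ z → (ι V ℚ.* z) ℚ.* (b j ℚ.* x ^ℚ k)) Q^d ⟩
    (ι V ℚ.* ι Q ^ℚ d) ℚ.* (b j ℚ.* x ^ℚ k)                      ∎
    where
    k = toℕ j
    N^k : ι N ^ℚ k ≡ x ^ℚ k ℚ.* ι Q ^ℚ k
    N^k = trans (cong (_^ℚ k) (sym x≡N/Q)) (^ℚ-distrib-* x (ι Q) k)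
    Q^d : ι Q ^ℚ k ℚ.* ι Q ^ℚ (d ∸ k) ≡ ι Q ^ℚ d
    Q^d = trans (^ℚ-+ (ι Q) k (d ∸ k)) (cong (ι Q ^ℚ_) (ℕP.m+[n∸m]≡n (FinP.toℕ≤pred[n] j)))

homogeneous-root : ∀ d c b V x → (∀ j → ι (c j) ≡ ι V ℚ.* b j) → evalPoly d b x ≡ 0ℚ →
                   sum (homTerm d c (ℚ.↥ x) (ℚ.↧ x)) ≡ 0ℤ
homogeneous-root d c b V x c≡Vb root = ι-injective {b = 0ℤ} (begin
  ι (sum (homTerm d c (ℚ.↥ x) (ℚ.↧ x)))          ≡⟨ homogenise d c b V (ℚ.↥ x) (ℚ.↧ x) x c≡Vb (↧-clears x) ⟩
  (ι V ℚ.* ι (ℚ.↧ x) ^ℚ d) ℚ.* evalPoly d b x    ≡⟨ cong ((ι V ℚ.* ι (ℚ.↧ x) ^ℚ d) ℚ.*_) root ⟩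
  (ι V ℚ.* ι (ℚ.↧ x) ^ℚ d) ℚ.* 0ℚ                ≡⟨ ℚP.*-zeroʳ (ι V ℚ.* ι (ℚ.↧ x) ^ℚ d) ⟩
  0ℚ                                             ∎)
  where open ≡-Reasoning

termSize : (d : ℕ) → (Fin (suc d) → ℤ) → ℕ → ℕ → Fin (suc d) → ℕ
termSize d c n q j = ∣ c j ∣ * n ^ toℕ j * q ^ (d ∸ toℕ j)

∣^∣ : ∀ a k → ∣ a ℤ.^ k ∣ ≡ ∣ a ∣ ^ k
∣^∣ a zero    = refl
∣^∣ a (suc k) = trans (ℤP.abs-* a (a ℤ.^ k)) (cong (∣ a ∣ *_) (∣^∣ a k))

∣homTerm∣ : ∀ d c N Q j → ∣ homTerm d c N Q j ∣ ≡ termSize d c ∣ N ∣ ∣ Q ∣ j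
∣homTerm∣ d c N Q j = trans (ℤP.abs-* (c j ℤ.* N ℤ.^ toℕ j) (Q ℤ.^ (d ∸ toℕ j)))
  (cong₂ _*_ (trans (ℤP.abs-* (c j) (N ℤ.^ toℕ j)) (cong (∣ c j ∣ *_) (∣^∣ N (toℕ j)))) (∣^∣ Q (d ∸ toℕ j)))

dominant-term : ∀ d c N Q k B → sum (homTerm d c N Q) ≡ 0ℤ →
                (∀ j → j ≢ k → termSize d c ∣ N ∣ ∣ Q ∣ j ≤ B) → termSize d c ∣ N ∣ ∣ Q ∣ k ≤ d * B
dominant-term d c N Q k B root others≤B = subst (_≤ d * B) (∣homTerm∣ d c N Q k)
  (vanishing-dominated (homTerm d c N Q) k B root (λ j j≢k → subst (_≤ B) (sym (∣homTerm∣ d c N Q j)) (others≤B j j≢k)))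

termSize-zero : ∀ d c n q → termSize d c n q zero ≡ q ^ d * ∣ c zero ∣
termSize-zero d c n q = trans (cong (_* q ^ d) (ℕP.*-identityʳ ∣ c zero ∣)) (ℕP.*-comm ∣ c zero ∣ (q ^ d))

termSize-last : ∀ d c n q → termSize d c n q (fromℕ d) ≡ n ^ d * ∣ c (fromℕ d) ∣
termSize-last d c n q rewrite FinP.toℕ-fromℕ d | ℕP.n∸n≡0 d =
  trans (ℕP.*-identityʳ (∣ c (fromℕ d) ∣ * n ^ d)) (ℕP.*-comm ∣ c (fromℕ d) ∣ (n ^ d))

below-top : ∀ {d} (j : Fin (suc d)) → j ≢ fromℕ d → toℕ j < d
below-top j j≢d = ℕP.≤∧≢⇒< (FinP.toℕ≤pred[n] j) (λ j≡d → j≢d (FinP.toℕ-injective (trans j≡d (sym (FinP.toℕ-fromℕ _)))))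

∣^ : ∀ X {k} → 1 ≤ k → X ∣ℤ X ℤ.^ k
∣^ X {suc k} _ = ∣m⇒∣m*n (X ℤ.^ k) ∣-refl

N∣homTerm : ∀ d c N Q j → j ≢ zero → N ∣ℤ homTerm d c N Q j
N∣homTerm d c N Q zero    j≢0 = ⊥-elim (j≢0 refl)
N∣homTerm d c N Q (suc j) _   = ∣m⇒∣m*n (Q ℤ.^ (d ∸ suc (toℕ j))) (∣n⇒∣m*n (c (suc j)) (∣^ N {suc (toℕ j)} (s≤s z≤n)))

Q∣homTerm : ∀ d c N Q j → j ≢ fromℕ d → Q ∣ℤ homTerm d c N Q j
Q∣homTerm d c N Q j j≢d = ∣n⇒∣m*n (c j ℤ.* N ℤ.^ toℕ j) (∣^ Q (ℕP.m<n⇒0<n∸m (below-top j j≢d)))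

coprime-^-divisor : ∀ {a b} k {x} → Coprime a b → a ∣ b ^ k * x → a ∣ x
coprime-^-divisor {a} zero    {x} _      a∣x = subst (a ∣_) (ℕP.+-identityʳ x) a∣x
coprime-^-divisor {a} {b} (suc k) {x} coprime a∣ = coprime-^-divisor k coprime
  (coprime-divisor coprime (subst (a ∣_) (ℕP.*-assoc b (b ^ k) x) a∣))

numerator∣constant : ∀ d c N q → sum (homTerm d c N (+ q)) ≡ 0ℤ → Coprime ∣ N ∣ q → ∣ N ∣ ∣ ∣ c zero ∣
numerator∣constant d c N q root coprime = coprime-^-divisor d coprime
  (subst (∣ N ∣ ∣_) (trans (∣homTerm∣ d c N (+ q) zero) (termSize-zero d c ∣ N ∣ q))
    (∣⇒∣ᵤ (vanishing-divides (homTerm d c N (+ q)) zero N root (N∣homTerm d c N (+ q)))))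

denominator∣leading : ∀ d c N q → sum (homTerm d c N (+ q)) ≡ 0ℤ → Coprime ∣ N ∣ q → q ∣ ∣ c (fromℕ d) ∣
denominator∣leading d c N q root coprime = coprime-^-divisor d (Coprimality.sym coprime)
  (subst (q ∣_) (trans (∣homTerm∣ d c N (+ q) (fromℕ d)) (termSize-last d c ∣ N ∣ q))
    (∣⇒∣ᵤ (vanishing-divides (homTerm d c N (+ q)) (fromℕ d) (+ q) root (Q∣homTerm d c N (+ q)))))

-- Euclid: every bound K is exceeded by a prime, namely any prime factor of K! + 1.
prime-above : ∀ K → ∃ λ P → Prime P × K < P
prime-above K = first-factor (PrimeFactorisation.factors F) (PrimeFactorisation.isFactorisation F) (PrimeFactorisation.factorsPrime F)
  where
  instance
    K!+1≢0 : NonZero (K ℕ.! + 1)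
    K!+1≢0 = ℕ.≢-nonZero (ℕP.m+1+n≢0 (K ℕ.!) {0})
  F : PrimeFactorisation (K ℕ.! + 1)
  F = factorise (K ℕ.! + 1)
  divides-own-factorial : ∀ p → .{{NonZero p}} → p ∣ p ℕ.!
  divides-own-factorial (suc p) = m∣m*n (p ℕ.!)
  prime-factor-exceeds : ∀ {p} → Prime p → p ∣ K ℕ.! + 1 → K < p
  prime-factor-exceeds {p} p-prime p∣ = ℕP.≰⇒> λ p≤K →
    ℕP.<-irrefl (sym (∣1⇒≡1 (∣m+n∣m⇒∣n p∣ (∣-trans (divides-own-factorial p {{prime⇒nonZero p-prime}}) (m≤n⇒m!∣n! p≤K)))))
                (ℕ.nonTrivial⇒n>1 p {{prime⇒nonTrivial p-prime}})
  first-factor : ∀ ps → K ℕ.! + 1 ≡ product ps → All Prime ps → ∃ λ P → Prime P × K < P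
  first-factor []       K!+1≡1 _              = ⊥-elim (ℕ.≢-nonZero⁻¹ (K ℕ.!) {{K ℕP.!≢0}} (ℕP.+-cancelʳ-≡ 1 (K ℕ.!) 0 K!+1≡1))
  first-factor (p ∷ ps) K!+1≡  (p-prime ∷ _)    = p , p-prime , prime-factor-exceeds p-prime (subst (p ∣_) (sym K!+1≡) (m∣m*n (product ps)))

prime-multiple-nonzero : ∀ {V P} → 1 ≤ V → Prime P → NonZero (V * P)
prime-multiple-nonzero {V} {P} 1≤V P-prime = ℕP.m*n≢0 V P {{ℕ.>-nonZero 1≤V}} {{prime⇒nonZero P-prime}}

divisor-of-prime-multiple : ∀ {V P} x → Prime P → 1 ≤ V → x ∣ V * P → x ≤ V ⊎ P ≤ x
divisor-of-prime-multiple {V} {P} zero    P-prime 1≤V 0∣VP =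
  ⊥-elim (ℕ.≢-nonZero⁻¹ (V * P) {{prime-multiple-nonzero 1≤V P-prime}} (0∣⇒≡0 0∣VP))
divisor-of-prime-multiple {V} {P} x@(suc _) P-prime 1≤V x∣VP with P ℕ.≤? x
... | yes P≤x = inj₂ P≤x
... | no  P≰x = inj₁ (∣⇒≤ {{ℕ.>-nonZero 1≤V}} (coprime-divisor (Coprimality.sym (prime⇒coprime P-prime (ℕP.≰⇒> P≰x)))
                                                               (subst (x ∣_) (ℕP.*-comm V P) x∣VP)))

^-mono-≤ : ∀ {x y a b} → 1 ≤ x → x ≤ y → a ≤ b → x ^ a ≤ y ^ b
^-mono-≤ {x} {y} {a} {b} 1≤x x≤y a≤b = ℕP.≤-trans (ℕP.^-monoʳ-≤ x {{ℕ.>-nonZero 1≤x}} a≤b) (ℕP.^-monoˡ-≤ b x≤y)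

^-positive : ∀ {x} a → 1 ≤ x → 1 ≤ x ^ a
^-positive {x} a 1≤x = ℕP.m^n>0 x {{ℕ.>-nonZero 1≤x}} a

*-mono₃-≤ : ∀ {a b c a′ b′ c′} → a ≤ a′ → b ≤ b′ → c ≤ c′ → a * b * c ≤ a′ * b′ * c′
*-mono₃-≤ a≤ b≤ c≤ = ℕP.*-mono-≤ (ℕP.*-mono-≤ a≤ b≤) c≤

*-rotate : ∀ a b c → a * (b * c) ≡ b * a * c
*-rotate = ℕ-Solver.solve-∀

*-swap-last : ∀ a b c → a * b * c ≡ a * c * b
*-swap-last = ℕ-Solver.solve-∀

threshold : ℕ → ℕ → ℕ
threshold d R = d * (R * R ^ d * R ^ d)

module NoRationalRoot
  (m : ℕ) (1≤m : 1 ≤ m) (i : Fin (suc (suc m))) (c : Fin (suc (suc m)) → ℤ) (V M P : ℕ)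
  (1≤V : 1 ≤ V) (c-i : c i ≡ + (V * P)) (c-others : ∀ j → j ≢ i → ∣ c j ∣ ≤ M)
  (c-zero : c zero ≢ 0ℤ) (c-last : c (fromℕ (suc m)) ≢ 0ℤ)
  (P-prime : Prime P) (P-large : threshold (suc m) (V + M) < P)
  where

  d R T : ℕ
  d = suc m
  R = V + M
  T = R * R ^ d

  1≤P : 1 ≤ P
  1≤P = ℕ.>-nonZero⁻¹ P {{prime⇒nonZero P-prime}}

  coefficient≤R : ∀ j → j ≢ i → ∣ c j ∣ ≤ R
  coefficient≤R j j≢i = ℕP.≤-trans (c-others j j≢i) (ℕP.m≤n+m M V)

  ∣c∣-at-i : ∀ {j} → j ≡ i → ∣ c j ∣ ≡ V * P
  ∣c∣-at-i refl = cong ∣_∣ c-i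

  prime-coefficient≤ : ∀ {u} → P ≤ u → V * P ≤ R * u ^ m
  prime-coefficient≤ {u} P≤u = ℕP.*-mono-≤ (ℕP.m≤m+n V M)
    (ℕP.≤-trans P≤u (subst (_≤ u ^ m) (ℕP.*-identityʳ u) (^-mono-≤ 1≤u ℕP.≤-refl 1≤m)))
    where 1≤u = ℕP.≤-trans 1≤P P≤u

  divisor-bound : ∀ k x → c k ≢ 0ℤ → x ∣ ∣ c k ∣ → x ≤ R ⊎ (i ≡ k × P ≤ x)
  divisor-bound k x ck≢0 x∣ck with i ≟ k
  ... | yes i≡k = ⊎-map (λ x≤V → ℕP.≤-trans x≤V (ℕP.m≤m+n V M)) (i≡k ,_)
                    (divisor-of-prime-multiple x P-prime 1≤V (subst (x ∣_) (∣c∣-at-i (sym i≡k)) x∣ck))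
  ... | no  i≢k = inj₁ (ℕP.≤-trans (∣⇒≤ {{ℕ.≢-nonZero (ck≢0 ∘ ℤP.∣i∣≡0⇒i≡0)}} x∣ck) (coefficient≤R k (i≢k ∘ sym)))

  below-threshold : ∀ {u} → P ≤ u → u ≤ d * T → ⊥
  below-threshold P≤u u≤dT = ℕP.<-irrefl refl (ℕP.<-≤-trans P-large (ℕP.≤-trans P≤u (ℕP.≤-trans u≤dT dT≤threshold)))
    where
    dT≤threshold : d * T ≤ threshold d R
    dT≤threshold = ℕP.*-monoʳ-≤ d (ℕP.m≤m*n T (R ^ d) {{ℕ.>-nonZero (^-positive d (ℕP.≤-trans 1≤V (ℕP.m≤m+n V M)))}})

  module AtRoot (N : ℤ) (q : ℕ) (1≤q : 1 ≤ q) (coprime : Coprime ∣ N ∣ q)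
                (root : sum (homTerm d c N (+ q)) ≡ 0ℤ) where

    n : ℕ
    n = ∣ N ∣

    size : Fin (suc d) → ℕ
    size = termSize d c n q

    n∣c₀ : n ∣ ∣ c zero ∣
    n∣c₀ = numerator∣constant d c N q root coprime

    q∣c_d : q ∣ ∣ c (fromℕ d) ∣
    q∣c_d = denominator∣leading d c N q root coprime

    1≤n : 1 ≤ n
    1≤n = ℕP.n≢0⇒n>0 (λ n≡0 → c-zero (ℤP.∣i∣≡0⇒i≡0 (0∣⇒≡0 (subst (_∣ ∣ c zero ∣) n≡0 n∣c₀))))

    -- If numerator and denominator are at most R, the prime term is too large
    -- for the others (each at most R·R^d·R^d) to cancel it.
    small-root : n ≤ R → q ≤ R → ⊥
    small-root n≤R q≤R = ℕP.<-irrefl refl (ℕP.<-≤-trans P-large (ℕP.≤-trans P≤size-i (dominant-term d c N (+ q) i _ root others≤)))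
      where
      others≤ : ∀ j → j ≢ i → size j ≤ R * R ^ d * R ^ d
      others≤ j j≢i = *-mono₃-≤ (coefficient≤R j j≢i) (^-mono-≤ 1≤n n≤R (FinP.toℕ≤pred[n] j)) (^-mono-≤ 1≤q q≤R (ℕP.m∸n≤m d (toℕ j)))
      P≤size-i : P ≤ size i
      P≤size-i = begin
        P                                              ≤⟨ ℕP.m≤n*m P V {{ℕ.>-nonZero 1≤V}} ⟩
        V * P                                          ≤⟨ ℕP.m≤m*n (V * P) _ {{ℕ.>-nonZero (^-positive (toℕ i) 1≤n)}} ⟩
        V * P * n ^ toℕ i                              ≤⟨ ℕP.m≤m*n (V * P * n ^ toℕ i) _ {{ℕ.>-nonZero (^-positive (d ∸ toℕ i) 1≤q)}} ⟩
        V * P * n ^ toℕ i * q ^ (d ∸ toℕ i)            ≡⟨ cong (λ z → z * n ^ toℕ i * q ^ (d ∸ toℕ i)) (∣c∣-at-i refl) ⟨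
        size i                                         ∎
        where open ℕP.≤-Reasoning

    -- A large u with an end term of size u^d·|c_k| (c_k ≠ 0), against all other
    -- terms bounded by T·u^m: dominance forces u ≤ d·T, contradicting P ≤ u.
    large-end-term : ∀ k u → size k ≡ u ^ d * ∣ c k ∣ → c k ≢ 0ℤ → P ≤ u →
                     (∀ j → j ≢ k → size j ≤ T * u ^ m) → ⊥
    large-end-term k u size-k ck≢0 P≤u others≤ = below-threshold P≤u (ℕP.*-cancelʳ-≤ u (d * T) (u ^ m) {{u^m≢0}} (begin
      u * u ^ m               ≤⟨ ℕP.m≤m*n (u ^ d) ∣ c k ∣ {{ℕ.≢-nonZero (ck≢0 ∘ ℤP.∣i∣≡0⇒i≡0)}} ⟩
      u ^ d * ∣ c k ∣         ≡⟨ size-k ⟨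
      size k                  ≤⟨ dominant-term d c N (+ q) k _ root others≤ ⟩
      d * (T * u ^ m)         ≡⟨ ℕP.*-assoc d T (u ^ m) ⟨
      d * T * u ^ m           ∎))
      where
      open ℕP.≤-Reasoning
      u^m≢0 : NonZero (u ^ m)
      u^m≢0 = ℕ.>-nonZero (^-positive m (ℕP.≤-trans 1≤P P≤u))

    -- The prime sits in the constant term and P ≤ n: the leading term dominates.
    large-numerator : i ≡ zero → P ≤ n → q ≤ R → ⊥
    large-numerator i≡0 P≤n q≤R = large-end-term (fromℕ d) n (termSize-last d c n q) c-last P≤n others≤
      where
      others≤ : ∀ j → j ≢ fromℕ d → size j ≤ T * n ^ m
      others≤ zero _ = begin
        size zero                     ≡⟨ termSize-zero d c n q ⟩
        q ^ d * ∣ c zero ∣            ≡⟨ cong (q ^ d *_) (∣c∣-at-i (sym i≡0)) ⟩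
        q ^ d * (V * P)               ≤⟨ ℕP.*-mono-≤ (^-mono-≤ 1≤q q≤R (ℕP.≤-refl {d})) (prime-coefficient≤ P≤n) ⟩
        R ^ d * (R * n ^ m)           ≡⟨ *-rotate (R ^ d) R (n ^ m) ⟩
        T * n ^ m                     ∎
        where open ℕP.≤-Reasoning
      others≤ j@(suc j′) j≢d = begin
        size j                        ≤⟨ *-mono₃-≤ (coefficient≤R j (λ j≡i → FinP.0≢1+n (trans (sym i≡0) (sym j≡i))))
                                                   (^-mono-≤ 1≤n ℕP.≤-refl (below-top j′ (j≢d ∘ cong suc)))
                                                   (^-mono-≤ 1≤q q≤R (ℕP.m∸n≤m d (toℕ j))) ⟩
        R * n ^ m * R ^ d             ≡⟨ *-swap-last R (n ^ m) (R ^ d) ⟩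
        T * n ^ m                     ∎
        where open ℕP.≤-Reasoning

    -- The prime sits in the leading term and P ≤ q: the constant term dominates.
    large-denominator : i ≡ fromℕ d → P ≤ q → n ≤ R → ⊥
    large-denominator i≡d P≤q n≤R = large-end-term zero q (termSize-zero d c n q) c-zero P≤q others≤
      where
      others≤ : ∀ j → j ≢ zero → size j ≤ T * q ^ m
      others≤ zero j≢0 = ⊥-elim (j≢0 refl)
      others≤ j@(suc j′) _ with j ≟ fromℕ d
      ... | yes j≡d = begin
        size j                        ≡⟨ cong size j≡d ⟩
        size (fromℕ d)                ≡⟨ termSize-last d c n q ⟩
        n ^ d * ∣ c (fromℕ d) ∣       ≡⟨ cong (n ^ d *_) (∣c∣-at-i (sym i≡d)) ⟩
        n ^ d * (V * P)               ≤⟨ ℕP.*-mono-≤ (^-mono-≤ 1≤n n≤R (ℕP.≤-refl {d})) (prime-coefficient≤ P≤q) ⟩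
        R ^ d * (R * q ^ m)           ≡⟨ *-rotate (R ^ d) R (q ^ m) ⟩
        T * q ^ m                     ∎
        where open ℕP.≤-Reasoning
      ... | no  j≢d = *-mono₃-≤ (coefficient≤R j (λ j≡i → j≢d (trans j≡i i≡d)))
                                (^-mono-≤ 1≤n n≤R (FinP.toℕ≤pred[n] j))
                                (^-mono-≤ 1≤q ℕP.≤-refl (ℕP.m∸n≤m m (toℕ j′)))

    -- By the rational root theorem each of n, q is at most R or at least P
    -- (the latter only next to the prime coefficient); all cases are impossible.
    impossible : ⊥
    impossible = by-cases (divisor-bound zero n c-zero n∣c₀) (divisor-bound (fromℕ d) q c-last q∣c_d)
      where
      by-cases : n ≤ R ⊎ (i ≡ zero × P ≤ n) → q ≤ R ⊎ (i ≡ fromℕ d × P ≤ q) → ⊥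
      by-cases (inj₁ n≤R)         (inj₁ q≤R)         = small-root n≤R q≤R
      by-cases (inj₂ (i≡0 , P≤n)) (inj₁ q≤R)         = large-numerator i≡0 P≤n q≤R
      by-cases (inj₁ n≤R)         (inj₂ (i≡d , P≤q)) = large-denominator i≡d P≤q n≤R
      by-cases (inj₂ (i≡0 , _))   (inj₂ (i≡d , _))   = FinP.0≢1+n (trans (sym i≡0) i≡d)

  no-root : ∀ N q → 1 ≤ q → Coprime ∣ N ∣ q → sum (homTerm d c N (+ q)) ≢ 0ℤ
  no-root N q 1≤q coprime root = AtRoot.impossible N q 1≤q coprime root

-- Clearing denominators: a finite family of rationals becomes integral after
-- multiplication by a positive integer V (the product of the denominators).
clear-denominators : ∀ {n} (a : Fin n → ℚ) →
                     ∃ λ V → ∃ λ (e : Fin n → ℤ) → 1 ≤ V × (∀ j → ι (e j) ≡ ι (+ V) ℚ.* a j)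
clear-denominators {zero}  a = 1 , (λ ()) , s≤s z≤n , (λ ())
clear-denominators {suc n} a with clear-denominators (a ∘ suc)
... | V , e , 1≤V , e-clears = D * V , e′ , ℕP.*-mono-≤ {1} {D} (s≤s z≤n) 1≤V , e′-clears
  where
  D : ℕ
  D = ℚ.↧ₙ (a zero)
  e′ : Fin (suc n) → ℤ
  e′ zero    = ℚ.↥ (a zero) ℤ.* + V
  e′ (suc j) = + D ℤ.* e j
  rearrange : ∀ p d v → p ℚ.* d ℚ.* v ≡ d ℚ.* v ℚ.* p
  rearrange = solve 3 (λ p d v → p :* d :* v := d :* v :* p) refl
  e′-clears : ∀ j → ι (e′ j) ≡ ι (+ (D * V)) ℚ.* a j
  e′-clears zero    = begin
    ι (ℚ.↥ (a zero) ℤ.* + V)                  ≡⟨ ι-* (ℚ.↥ (a zero)) (+ V) ⟩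
    ι (ℚ.↥ (a zero)) ℚ.* ι (+ V)              ≡⟨ cong (ℚ._* ι (+ V)) (↧-clears (a zero)) ⟨
    a zero ℚ.* ι (+ D) ℚ.* ι (+ V)            ≡⟨ rearrange (a zero) (ι (+ D)) (ι (+ V)) ⟩
    ι (+ D) ℚ.* ι (+ V) ℚ.* a zero            ≡⟨ cong (ℚ._* a zero) (ι-pos-* D V) ⟨
    ι (+ (D * V)) ℚ.* a zero                  ∎
    where open ≡-Reasoning
  e′-clears (suc j) = begin
    ι (+ D ℤ.* e j)                           ≡⟨ ι-* (+ D) (e j) ⟩
    ι (+ D) ℚ.* ι (e j)                       ≡⟨ cong (ι (+ D) ℚ.*_) (e-clears j) ⟩
    ι (+ D) ℚ.* (ι (+ V) ℚ.* a (suc j))       ≡⟨ ℚP.*-assoc (ι (+ D)) (ι (+ V)) (a (suc j)) ⟨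
    ι (+ D) ℚ.* ι (+ V) ℚ.* a (suc j)         ≡⟨ cong (ℚ._* a (suc j)) (ι-pos-* D V) ⟨
    ι (+ (D * V)) ℚ.* a (suc j)               ∎
    where open ≡-Reasoning

cleared-nonzero : ∀ {V e a} → 1 ≤ V → ι e ≡ ι (+ V) ℚ.* a → a ≢ 0ℚ → e ≢ 0ℤ
cleared-nonzero {V} {e} {a} 1≤V e-clears a≢0 e≡0 =
  [ V≢0 , a≢0 ]′ (ℚ-zero-product (ι (+ V)) a (trans (sym e-clears) (cong ι e≡0)))
  where
  V≢0 : ι (+ V) ≢ 0ℚ
  V≢0 V≡0 = ℕP.<⇒≢ 1≤V (sym (ℤP.+-injective (ι-injective {b = 0ℤ} V≡0)))

finite-bound : ∀ {n} (f : Fin n → ℕ) → ∃ λ B → ∀ j → f j ≤ B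
finite-bound {zero}  f = 0 , λ ()
finite-bound {suc n} f with finite-bound (f ∘ suc)
... | B , f≤B = f zero ℕ.⊔ B , λ { zero → ℕP.m≤m⊔n (f zero) B ; (suc j) → ℕP.≤-trans (f≤B j) (ℕP.m≤n⊔m (f zero) B) }

setCoeff-here : ∀ {n} (a : Fin n → ℚ) i z → setCoeff a i z i ≡ z
setCoeff-here a i z with i ≟ i
... | yes _   = refl
... | no  i≢i = ⊥-elim (i≢i refl)

setCoeff-elsewhere : ∀ {n} (a : Fin n → ℚ) i z j → j ≢ i → setCoeff a i z j ≡ a j
setCoeff-elsewhere a i z j j≢i with j ≟ i
... | yes j≡i = ⊥-elim (j≢i j≡i)
... | no  _   = refl

replaced-clears : ∀ {n} (a : Fin n → ℚ) (e : Fin n → ℤ) V P i → (∀ j → ι (e j) ≡ ι (+ V) ℚ.* a j) →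
                  ∀ j → ι (updateAt e i (λ _ → + (V * P)) j) ≡ ι (+ V) ℚ.* setCoeff a i (ι (+ P)) j
replaced-clears a e V P i e-clears j = by-cases (j ≟ i)
  where
  open ≡-Reasoning
  here : ι (updateAt e i (λ _ → + (V * P)) i) ≡ ι (+ V) ℚ.* setCoeff a i (ι (+ P)) i
  here = begin
    ι (updateAt e i (λ _ → + (V * P)) i)      ≡⟨ cong ι (updateAt-updates i e) ⟩
    ι (+ (V * P))                             ≡⟨ ι-pos-* V P ⟩
    ι (+ V) ℚ.* ι (+ P)                       ≡⟨ cong (ι (+ V) ℚ.*_) (setCoeff-here a i (ι (+ P))) ⟨
    ι (+ V) ℚ.* setCoeff a i (ι (+ P)) i      ∎
  by-cases : Dec (j ≡ i) → ι (updateAt e i (λ _ → + (V * P)) j) ≡ ι (+ V) ℚ.* setCoeff a i (ι (+ P)) j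
  by-cases (yes j≡i) = subst (λ k → ι (updateAt e i (λ _ → + (V * P)) k) ≡ ι (+ V) ℚ.* setCoeff a i (ι (+ P)) k) (sym j≡i) here
  by-cases (no  j≢i) = begin
    ι (updateAt e i (λ _ → + (V * P)) j)      ≡⟨ cong ι (updateAt-minimal j i e j≢i) ⟩
    ι (e j)                                   ≡⟨ e-clears j ⟩
    ι (+ V) ℚ.* a j                           ≡⟨ cong (ι (+ V) ℚ.*_) (setCoeff-elsewhere a i (ι (+ P)) j j≢i) ⟨
    ι (+ V) ℚ.* setCoeff a i (ι (+ P)) j      ∎

replaced-nonzero : ∀ {n} (a : Fin n → ℚ) (e : Fin n → ℤ) {V P} i k → 1 ≤ V → Prime P →
                   (∀ j → ι (e j) ≡ ι (+ V) ℚ.* a j) → (i ≢ k → a k ≢ 0ℚ) →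
                   updateAt e i (λ _ → + (V * P)) k ≢ 0ℤ
replaced-nonzero a e {V} {P} i k 1≤V P-prime e-clears ak≢0 with k ≟ i
... | yes refl = λ ck≡0 → ℕ.≢-nonZero⁻¹ (V * P) {{prime-multiple-nonzero 1≤V P-prime}}
                            (ℤP.+-injective (trans (sym (updateAt-updates k e)) ck≡0))
... | no  k≢i  = subst (_≢ 0ℤ) (sym (updateAt-minimal k i e k≢i))
                       (cleared-nonzero 1≤V (e-clears k) (ak≢0 (k≢i ∘ sym)))

proposition4p2 : (d : ℕ) → d ≥ 2 → (i : Fin (suc d)) → (a : Fin (suc d) → ℚ)
    → (i ≢ zero → a zero ≢ 0ℚ)
    → (i ≢ fromℕ d → a (fromℕ d) ≢ 0ℚ)
    → ∃ λ (aᵢ : ℤ) → (aᵢ ≢ 0ℤ)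
    × ((x : ℚ) → evalPoly d (setCoeff a i (aᵢ / 1)) x ≢ 0ℚ)
proposition4p2 (suc m) (s≤s 1≤m) i a a₀≢0 a_d≢0 with clear-denominators a
... | V , e , 1≤V , e-clears with finite-bound (∣_∣ ∘ e)
... | M , e≤M with prime-above (threshold (suc m) (V + M))
... | P , P-prime , P-large = + P , +P≢0 , no-rational-root
  where
  +P≢0 : + P ≢ 0ℤ
  +P≢0 P≡0 = ℕ.≢-nonZero⁻¹ P {{prime⇒nonZero P-prime}} (ℤP.+-injective P≡0)
  c : Fin (suc (suc m)) → ℤ
  c = updateAt e i (λ _ → + (V * P))
  c-others : ∀ j → j ≢ i → ∣ c j ∣ ≤ M
  c-others j j≢i = subst (λ z → ∣ z ∣ ≤ M) (sym (updateAt-minimal j i e j≢i)) (e≤M j)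
  c-nonzero : ∀ k → (i ≢ k → a k ≢ 0ℚ) → c k ≢ 0ℤ
  c-nonzero k = replaced-nonzero a e i k 1≤V P-prime e-clears
  open NoRationalRoot m 1≤m i c V M P 1≤V (updateAt-updates i e) c-others
                      (c-nonzero zero a₀≢0) (c-nonzero (fromℕ (suc m)) a_d≢0) P-prime P-large
  no-rational-root : ∀ x → evalPoly (suc m) (setCoeff a i (+ P / 1)) x ≢ 0ℚ
  no-rational-root x@(mkℚ N q-1 coprime) root = no-root N (suc q-1) (s≤s z≤n) (Coprimality.recompute coprime)
    (homogeneous-root (suc m) c _ (+ V) x (replaced-clears a e V P i e-clears) root)
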